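{- Let $(P,\mathrm{org})$ be a valid DAG-depth decomposition of a finite digraph $D$. Let $C$ be the digraph with $V(C)=V(D)$ whose edges are exactly the pairs $(u,v)$ with $u,v\in V(D)$ such that for every copy $u'\in V(P)$ of $u$, either (1) there is a copy $v'$ of $v$ that is a descendant of $u'$ in $P$, or (2) every directed path in $P$ from a root of $P$ to $u'$ contains a copy of $v$. Then $C$ is a closure of $(P,\mathrm{org})$, and the closure of $(P,\mathrm{org})$ is unique (namely $C$).
   Context: A DAG is an acyclic digraph. In a DAG $P$, a root is a vertex of indegree $0$; $y$ is a descendant of $x$ if $P$ contains a directed path from $x$ to $y$. For a digraph $D$ and $v\in V(D)$, $N_D^+(v)=\{x:(v,x)\in E(D)\}$. A DAG-depth decomposition of $D$ is a pair $(P,\mathrm{org})$ where $P$ is a DAG and $\mathrm{org}:V(P)\to V(D)$ is surjective; $x'$ with $\mathrm{org}(x')=x$ is a copy of $x$. It is valid (for $D$) if for every $v'\in V(P)$ with $\mathrm{org}(v')=v$ and every $u\in N_D^+(v)$, either (1) there is a copy $u'$ of $u$ that is a descendant of $v'$ in $P$, or (2) every directed path in $P$ from a root of $P$ to $v'$ contains a copy of $u$. A partial closure of a DAG-depth decomposition $(P,\mathrm{org})$ of $D$ is a digraph $C'$ with $V(C')=V(D)$ such that $D$ is a spanning subgraph of $C'$ and $(P,\mathrm{org})$ is a valid DAG-depth decomposition of $C'$. A closure is a partial closure that is maximal with respect to inclusion of edge sets. -}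

module Defs where

open import Data.Nat using (ℕ)
open import Data.Fin using (Fin)
open import Data.Product using (Σ; ∃; _×_; _,_)
open import Data.Sum using (_⊎_)
open import Data.Empty using (⊥)
open import Relation.Nullary using (¬_)
open import Relation.Binary.PropositionalEquality using (_≡_)

Rel : ℕ → Set₁
Rel n = Fin n → Fin n → Set

_⊆ᴱ_ : {n : ℕ} → Rel n → Rel n → Set
_⊆ᴱ_ {n} A B = (x y : Fin n) → A x y → B x y

data Path {m : ℕ} (E : Rel m) : Fin m → Fin m → Set where
  []  : {x : Fin m} → Path E x x
  _∷_ : {x y z : Fin m} → E x y → Path E y z → Path E x z

data Contains {m : ℕ} {E : Rel m} (Q : Fin m → Set) : {x y : Fin m} → Path E x y → Set where
  here-end : {x : Fin m} → Q x → Contains Q ([] {x = x})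
  here     : {x y z : Fin m} (e : E x y) (p : Path E y z) → Q x → Contains Q (e ∷ p)
  there    : {x y z : Fin m} (e : E x y) (p : Path E y z) → Contains Q p → Contains Q (e ∷ p)

Descendant : {m : ℕ} → Rel m → Fin m → Fin m → Set
Descendant E x y = Path E x y

Acyclic : {m : ℕ} → Rel m → Set
Acyclic {m} E = {x y : Fin m} → E x y → Path E y x → ⊥

Root : {m : ℕ} → Rel m → Fin m → Set
Root {m} E r = (y : Fin m) → ¬ E y r

Surjective : {m n : ℕ} → (Fin m → Fin n) → Set
Surjective {m} {n} f = (y : Fin n) → ∃ λ x → f x ≡ y

record DAGDecomp (n : ℕ) : Set₁ where
  field
    m       : ℕ
    P       : Rel m
    acyclic : Acyclic P
    org     : Fin m → Fin n
    org-surj : Surjective org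

module _ {n : ℕ} (Dc : DAGDecomp n) where
  open DAGDecomp Dc

  Cond : Fin m → Fin n → Set
  Cond v' u =
    (Σ (Fin m) λ u' → (org u' ≡ u) × Descendant P v' u')
    ⊎ ((r : Fin m) → Root P r → (p : Path P r v') → Contains (λ w → org w ≡ u) p)

  Valid : Rel n → Set
  Valid A = (v' : Fin m) (u : Fin n) → A (org v') u → Cond v' u

  PartialClosure : Rel n → Rel n → Set
  PartialClosure D C' = (D ⊆ᴱ C') × Valid C'

  Closure : Rel n → Rel n → Set₁
  Closure D C' = PartialClosure D C' ×
    ((C'' : Rel n) → PartialClosure D C'' → C' ⊆ᴱ C'' → C'' ⊆ᴱ C')

  Ccan : Rel n
  Ccan u v = (u' : Fin m) → org u' ≡ u → Cond u' v

-- Validity of (P, org) for a digraph only constrains the out-edges of each vertex through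
-- a condition on its copies, so the valid digraphs are exactly the subgraphs of C. Hence C
-- is the greatest partial closure, and any closure, being maximal, must coincide with it.
module Submission where

open import Defs
open import Data.Nat using (ℕ)
open import Data.Product using (_×_; _,_; proj₁; proj₂)
open import Relation.Binary.PropositionalEquality using (refl)

module _ {n : ℕ} (Dc : DAGDecomp n) where

  valid⇒⊆Ccan : {A : Rel n} → Valid Dc A → A ⊆ᴱ Ccan Dc
  valid⇒⊆Ccan validA u v uv u' refl = validA u' v uv

  Ccan-valid : Valid Dc (Ccan Dc)
  Ccan-valid v' u c = c v' refl

  Ccan-partialClosure : {D : Rel n} → Valid Dc D → PartialClosure Dc D (Ccan Dc)
  Ccan-partialClosure validD = valid⇒⊆Ccan validD , Ccan-valid

  Ccan-closure : {D : Rel n} → Valid Dc D → Closure Dc D (Ccan Dc)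
  Ccan-closure validD =
    Ccan-partialClosure validD , λ C'' pc _ → valid⇒⊆Ccan (proj₂ pc)

  closure⇒⊇Ccan : {D C' : Rel n} → Valid Dc D → Closure Dc D C' → Ccan Dc ⊆ᴱ C'
  closure⇒⊇Ccan validD (pc , maximal) =
    maximal (Ccan Dc) (Ccan-partialClosure validD) (valid⇒⊆Ccan (proj₂ pc))

theorem5p1 : (n : ℕ) (D : Rel n) (Dc : DAGDecomp n) → Valid Dc D →
    Closure Dc D (Ccan Dc)
    × ((C' : Rel n) → Closure Dc D C' → (C' ⊆ᴱ Ccan Dc) × (Ccan Dc ⊆ᴱ C'))
theorem5p1 n D Dc validD =
  Ccan-closure Dc validD
  , λ C' closure → valid⇒⊆Ccan Dc (proj₂ (proj₁ closure)) , closure⇒⊇Ccan Dc validD closure
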